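{- Let $\mathbf A$ be a totally ordered Dunn monoid that is generated (as an RL) by a set $X$ of idempotent elements. Then $\mathbf A$ is idempotent.
   Context: A (commutative) residuated lattice (RL) is an algebra $\langle A;\cdot,\to,\wedge,\vee,e\rangle$ such that $\langle A;\cdot,e\rangle$ is a commutative monoid, $\langle A;\wedge,\vee\rangle$ is a lattice, and $x\cdot y\leqslant z \iff y\leqslant x\to z$. A Dunn monoid is an RL whose lattice reduct is distributive and which satisfies $x\leqslant x\cdot x$. An element $a$ is idempotent if $a\cdot a=a$; the algebra is idempotent if all its elements are. -}

module Defs where

open import Level using (Level; _⊔_) renaming (suc to lsuc)
open import Data.Product using (_×_)
open import Data.Sum using (_⊎_)
open import Relation.Binary.PropositionalEquality using (_≡_)
open import Relation.Unary using (Pred; _∈_)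
open import Algebra.Core using (Op₂)
import Algebra.Structures as AS
open import Algebra.Lattice.Structures using (IsLattice; IsDistributiveLattice)

record CommResiduatedLattice (c : Level) : Set (lsuc c) where
  infixl 7 _·_
  infixr 5 _⇒_
  infixr 6 _∧_
  infixr 5 _∨_
  infix 4 _≤_
  field
    Carrier : Set c
    _·_ _⇒_ _∧_ _∨_ : Op₂ Carrier
    e : Carrier
    isCommutativeMonoid : AS.IsCommutativeMonoid {A = Carrier} _≡_ _·_ e
    isLattice : IsLattice {A = Carrier} _≡_ _∨_ _∧_

  _≤_ : Carrier → Carrier → Set c
  x ≤ y = x ∧ y ≡ x

  field
    residuation-⇒ : ∀ x y z → x · y ≤ z → y ≤ x ⇒ z
    residuation-⇐ : ∀ x y z → y ≤ x ⇒ z → x · y ≤ z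

  IsIdempotentElement : Carrier → Set c
  IsIdempotentElement a = a · a ≡ a

  IsIdempotent : Set c
  IsIdempotent = ∀ a → IsIdempotentElement a

  IsTotallyOrdered : Set c
  IsTotallyOrdered = ∀ x y → (x ≤ y) ⊎ (y ≤ x)

  IsDunnMonoid : Set c
  IsDunnMonoid = IsDistributiveLattice {A = Carrier} _≡_ _∨_ _∧_ × (∀ x → x ≤ x · x)

  data Generated {ℓ : Level} (X : Pred Carrier ℓ) : Pred Carrier (c ⊔ ℓ) where
    gen  : ∀ {x} → x ∈ X → Generated X x
    gen-e : Generated X e
    gen-· : ∀ {x y} → Generated X x → Generated X y → Generated X (x · y)
    gen-⇒ : ∀ {x y} → Generated X x → Generated X y → Generated X (x ⇒ y)
    gen-∧ : ∀ {x y} → Generated X x → Generated X y → Generated X (x ∧ y)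
    gen-∨ : ∀ {x y} → Generated X x → Generated X y → Generated X (x ∨ y)

  GeneratedBy : {ℓ : Level} → Pred Carrier ℓ → Set (c ⊔ ℓ)
  GeneratedBy X = ∀ a → Generated X a

-- Every operation of a totally ordered Dunn monoid maps idempotents to
-- idempotents, so the idempotents form a subuniverse containing the
-- generators, hence everything. Meet and join are selective in a chain;
-- products of idempotents are idempotent by commutativity; and for
-- idempotent x, y, the element a = x ⇒ y satisfies x·(a·a) = (x·a)·(x·a) ≤ y·y = y,
-- so a·a ≤ a, while a ≤ a·a holds in any Dunn monoid.
module Submission where

open import Defs
open import Level using (Level; _⊔_)
open import Data.Product using (_,_; proj₁)
open import Data.Sum using (inj₁; inj₂)
open import Relation.Unary using (Pred; _∈_; _⊆_)
open import Relation.Binary.PropositionalEquality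
  using (_≡_; sym; trans; cong; cong₂; subst; subst₂; module ≡-Reasoning)
open import Relation.Binary.Bundles using (Poset)
open import Algebra.Core using (Op₂)
open import Algebra.Bundles using (CommutativeMonoid)
open import Algebra.Lattice.Bundles using (Lattice)
open import Algebra.Lattice.Structures using (IsLattice)
import Algebra.Lattice.Properties.Lattice as LatticeProperties
import Algebra.Properties.CommutativeSemigroup as CommutativeSemigroupProperties

module ResiduatedLatticeProperties {c : Level} (A : CommResiduatedLattice c) where
  open CommResiduatedLattice A
  open import Algebra.Definitions (_≡_ {A = Carrier}) using (Selective)

  lattice : Lattice c c
  lattice = record
    { Carrier = Carrier ; _≈_ = _≡_ ; _∨_ = _∨_ ; _∧_ = _∧_ ; isLattice = isLattice }

  ·-commutativeMonoid : CommutativeMonoid c c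
  ·-commutativeMonoid = record
    { Carrier = Carrier ; _≈_ = _≡_ ; _∙_ = _·_ ; ε = e ; isCommutativeMonoid = isCommutativeMonoid }

  open LatticeProperties lattice using (poset; ∧-idem)
  open IsLattice isLattice using (∧-comm; ∨-comm; absorptive)
  open CommutativeMonoid ·-commutativeMonoid using (comm; identityˡ; commutativeSemigroup)
  open CommutativeSemigroupProperties commutativeSemigroup using (interchange)
  private module P = Poset poset

  -- The library's natural order is x ≈ x ∧ y, the converse equation of ours.
  ≤-refl : ∀ x → x ≤ x
  ≤-refl = ∧-idem

  ≤-trans : ∀ {x y z} → x ≤ y → y ≤ z → x ≤ z
  ≤-trans p q = sym (P.trans (sym p) (sym q))

  ≤-antisym : ∀ {x y} → x ≤ y → y ≤ x → x ≡ y
  ≤-antisym p q = P.antisym (sym p) (sym q)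

  x≤y⇒x∨y≡y : ∀ {x y} → x ≤ y → x ∨ y ≡ y
  x≤y⇒x∨y≡y {x} {y} p = begin
    x ∨ y        ≡⟨ cong (_∨ y) (sym p) ⟩
    (x ∧ y) ∨ y  ≡⟨ ∨-comm (x ∧ y) y ⟩
    y ∨ (x ∧ y)  ≡⟨ cong (y ∨_) (∧-comm x y) ⟩
    y ∨ (y ∧ x)  ≡⟨ proj₁ absorptive y x ⟩
    y            ∎
    where open ≡-Reasoning

  ·⇒-counit : ∀ x y → x · (x ⇒ y) ≤ y
  ·⇒-counit x y = residuation-⇐ x (x ⇒ y) y (≤-refl (x ⇒ y))

  ·-monoʳ-≤ : ∀ z {x y} → x ≤ y → z · x ≤ z · y
  ·-monoʳ-≤ z {x} {y} x≤y =
    residuation-⇐ z x (z · y) (≤-trans x≤y (residuation-⇒ z y (z · y) (≤-refl (z · y))))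

  ·-mono-≤ : ∀ {x y u v} → x ≤ y → u ≤ v → x · u ≤ y · v
  ·-mono-≤ {x} {y} {u} {v} x≤y u≤v = ≤-trans (·-monoʳ-≤ x u≤v)
    (subst₂ _≤_ (comm v x) (comm v y) (·-monoʳ-≤ v x≤y))

  ∧-selective : IsTotallyOrdered → Selective _∧_
  ∧-selective total x y with total x y
  ... | inj₁ x≤y = inj₁ x≤y
  ... | inj₂ y≤x = inj₂ (trans (∧-comm x y) y≤x)

  ∨-selective : IsTotallyOrdered → Selective _∨_
  ∨-selective total x y with total x y
  ... | inj₁ x≤y = inj₂ (x≤y⇒x∨y≡y x≤y)
  ... | inj₂ y≤x = inj₁ (trans (∨-comm x y) (x≤y⇒x∨y≡y y≤x))

  selective-preserves : ∀ {p} (P : Pred Carrier p) {_∙_ : Op₂ Carrier} → Selective _∙_ →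
                        ∀ {x y} → P x → P y → P (x ∙ y)
  selective-preserves P sel {x} {y} px py with sel x y
  ... | inj₁ eq = subst P (sym eq) px
  ... | inj₂ eq = subst P (sym eq) py

  ·-preserves-idempotent : ∀ {x y} → IsIdempotentElement x → IsIdempotentElement y →
                           IsIdempotentElement (x · y)
  ·-preserves-idempotent {x} {y} xx≡x yy≡y = trans (interchange x y x y) (cong₂ _·_ xx≡x yy≡y)

  ⇒-preserves-idempotent : (∀ x → x ≤ x · x) → ∀ {x y} → IsIdempotentElement x →
                           IsIdempotentElement y → IsIdempotentElement (x ⇒ y)
  ⇒-preserves-idempotent square-increasing {x} {y} xx≡x yy≡y =
    ≤-antisym (residuation-⇒ x (a · a) y x·aa≤y) (square-increasing a)
    where
      a = x ⇒ y
      x·aa≤y : x · (a · a) ≤ y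
      x·aa≤y = subst₂ _≤_
        (trans (interchange x a x a) (cong (_· (a · a)) xx≡x)) yy≡y
        (·-mono-≤ (·⇒-counit x y) (·⇒-counit x y))

  record IsSubuniverse {p : Level} (P : Pred Carrier p) : Set (c ⊔ p) where
    field
      e-closed : P e
      ·-closed : ∀ {x y} → P x → P y → P (x · y)
      ⇒-closed : ∀ {x y} → P x → P y → P (x ⇒ y)
      ∧-closed : ∀ {x y} → P x → P y → P (x ∧ y)
      ∨-closed : ∀ {x y} → P x → P y → P (x ∨ y)

  module _ {p : Level} {P : Pred Carrier p} (S : IsSubuniverse P) where
    open IsSubuniverse S

    Generated⊆ : ∀ {ℓ} {X : Pred Carrier ℓ} → X ⊆ P → Generated X ⊆ P
    Generated⊆ X⊆P (gen x∈X)   = X⊆P x∈X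
    Generated⊆ X⊆P gen-e       = e-closed
    Generated⊆ X⊆P (gen-· x y) = ·-closed (Generated⊆ X⊆P x) (Generated⊆ X⊆P y)
    Generated⊆ X⊆P (gen-⇒ x y) = ⇒-closed (Generated⊆ X⊆P x) (Generated⊆ X⊆P y)
    Generated⊆ X⊆P (gen-∧ x y) = ∧-closed (Generated⊆ X⊆P x) (Generated⊆ X⊆P y)
    Generated⊆ X⊆P (gen-∨ x y) = ∨-closed (Generated⊆ X⊆P x) (Generated⊆ X⊆P y)

  idempotents-isSubuniverse : IsDunnMonoid → IsTotallyOrdered → IsSubuniverse IsIdempotentElement
  idempotents-isSubuniverse (_ , square-increasing) total = record
    { e-closed = identityˡ e
    ; ·-closed = ·-preserves-idempotent
    ; ⇒-closed = ⇒-preserves-idempotent square-increasing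
    ; ∧-closed = selective-preserves IsIdempotentElement (∧-selective total)
    ; ∨-closed = selective-preserves IsIdempotentElement (∨-selective total)
    }

theorem6p16 : {c ℓ : Level} (A : CommResiduatedLattice c) (X : Pred (CommResiduatedLattice.Carrier A) ℓ) →
    CommResiduatedLattice.IsDunnMonoid A →
    CommResiduatedLattice.IsTotallyOrdered A →
    (∀ {x} → x ∈ X → CommResiduatedLattice.IsIdempotentElement A x) →
    CommResiduatedLattice.GeneratedBy A X →
    CommResiduatedLattice.IsIdempotent A
theorem6p16 A X dunn total X-idempotent generated a =
  Generated⊆ (idempotents-isSubuniverse dunn total) X-idempotent (generated a)
  where open ResiduatedLatticeProperties A
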